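{- Let $G$ be a nontrivial finite abelian $p$-group. Then $\kappa(\mathcal{G}(G))=\delta(\mathcal{G}(G))$ if and only if $\sigma(G)=1$ or $\tau(G)=2$.
   Context: A $p$-group is a finite group whose order is a power of the prime $p$. A finite abelian group $G$ is isomorphic to a unique direct product of cyclic groups of prime power order; $\sigma(G)$ is the number of cyclic factors and $\tau(G)$ the order of the smallest cyclic factor. The power graph $\mathcal{G}(G)$ has vertex set $G$, distinct $u,v$ adjacent iff one is a positive integer power of the other. $\delta$ is minimum degree and $\kappa$ vertex connectivity (minimum number of vertices whose removal yields a disconnected or trivial graph). -}

module Defs where

open import Data.Nat using (ℕ; _+_; _*_; _^_; _≤_; _⊓_)
open import Data.Fin using (Fin; toℕ)
open import Data.Product using (_×_; _,_; ∃; Σ)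
open import Data.Sum using (_⊎_)
open import Data.Unit using (⊤)
open import Data.List using (List; []; _∷_; length; foldr; map)
open import Data.List.NonEmpty using (List⁺; _∷_; toList)
open import Data.List.Membership.Propositional using (_∈_; _∉_)
open import Data.List.Relation.Unary.Unique.Propositional using (Unique)
open import Relation.Binary.PropositionalEquality using (_≡_; _≢_)
open import Function.Bundles using (_⇔_)

record Graph : Set₁ where
  field
    V   : Set
    Adj : V → V → Set

module _ (G : Graph) where
  open Graph G

  IsNeighbourList : V → List V → Set
  IsNeighbourList v L = Unique L × (∀ w → (w ∈ L) ⇔ Adj v w)

  HasDegree : V → ℕ → Set
  HasDegree v d = Σ (List V) λ L → IsNeighbourList v L × length L ≡ d

  IsMinDegree : ℕ → Set
  IsMinDegree d = (∃ λ v → HasDegree v d) × (∀ v e → HasDegree v e → d ≤ e)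

  data ReachAvoiding (S : List V) : V → V → Set where
    here : ∀ {u} → ReachAvoiding S u u
    step : ∀ {u x w} → Adj u x → x ∉ S → ReachAvoiding S x w → ReachAvoiding S u w

  TrivialAfterRemoving : List V → Set
  TrivialAfterRemoving S = ∀ u w → u ∉ S → w ∉ S → u ≡ w

  DisconnectedAfterRemoving : List V → Set
  DisconnectedAfterRemoving S =
    Σ V λ u → Σ V λ w → u ∉ S × w ∉ S × (ReachAvoiding S u w → Data.Empty.⊥)
    where import Data.Empty

  IsSeparating : List V → Set
  IsSeparating S = Unique S × (DisconnectedAfterRemoving S ⊎ TrivialAfterRemoving S)

  IsVertexConnectivity : ℕ → Set
  IsVertexConnectivity k =
    (Σ (List V) λ S → IsSeparating S × length S ≡ k)
    × (∀ S → IsSeparating S → k ≤ length S)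

-- The finite abelian group Z/n₁ × ... × Z/nᵣ (moduli given as a list)

Elem : List ℕ → Set
Elem []       = ⊤
Elem (n ∷ ns) = Fin n × Elem ns

-- IsMultiple m u v  :  v = m·u  (i.e. v = u^m in multiplicative notation),
-- componentwise congruence  m·uᵢ ≡ vᵢ (mod nᵢ)
IsMultiple : (ns : List ℕ) → ℕ → Elem ns → Elem ns → Set
IsMultiple []       m _        _        = ⊤
IsMultiple (n ∷ ns) m (u , us) (v , vs) =
  (∃ λ t → m * toℕ u ≡ toℕ v + t * n) × IsMultiple ns m us vs

IsPowerOf : (ns : List ℕ) → Elem ns → Elem ns → Set
IsPowerOf ns u v = ∃ λ m → 1 ≤ m × IsMultiple ns m u v

PowerGraphProd : List ℕ → Graph
PowerGraphProd ns = record
  { V   = Elem ns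
  ; Adj = λ u v → u ≢ v × (IsPowerOf ns u v ⊎ IsPowerOf ns v u) }

-- The abelian p-group  Z/p^{a₁} × ... × Z/p^{aᵣ}  (r ≥ 1)

moduli : ℕ → List⁺ ℕ → List ℕ
moduli p a = map (p ^_) (toList a)

PGroupPowerGraph : ℕ → List⁺ ℕ → Graph
PGroupPowerGraph p a = PowerGraphProd (moduli p a)

σ : List⁺ ℕ → ℕ
σ a = length (toList a)

minExp : List⁺ ℕ → ℕ
minExp (x ∷ xs) = foldr _⊓_ x xs

τ : ℕ → List⁺ ℕ → ℕ
τ p a = p ^ minExp a

module Submission where

-- Cyclic case (r = 1): of two residues modulo p^a one is always a positive multiple of the other
-- (write both as unit · power of p and invert the unit), so the power graph is complete and κ = δ
-- holds in every complete graph.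
-- Non-cyclic case (r ≥ 2): 0 is adjacent to everything, so κ ≥ 1; and {0} separates, because the
-- property "the multiple of x of order p has a nonzero first coordinate" is invariant along edges
-- avoiding 0 and separates (p^(a₁-1), 0, …) from (0, p^(a₂-1), 0, …).  Hence κ = 1, and it remains
-- to compare δ with 1:
--   * if τ = 2, the generator of a factor Z/2 has 0 as its only neighbour, so δ = 1;
--   * otherwise every element of order 2 is a double, which gives every vertex two neighbours: δ ≥ 2.

open import Defs
open import Data.Empty using (⊥-elim)
open import Data.Fin using (Fin; toℕ; fromℕ<)
open import Data.Fin.Properties using (toℕ-fromℕ<; toℕ-injective; toℕ<n) renaming (_≟_ to _≟ᶠ_)
open import Data.List using (List; []; _∷_; length; map)
open import Data.List.Membership.Propositional using (_∈_; _∉_; find)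
open import Data.List.Membership.Propositional.Properties using (foldr-selective)
import Data.List.Membership.DecPropositional as DecMembership
open import Data.List.NonEmpty using (List⁺; _∷_; toList)
open import Data.List.Properties
  using (length-removeAt′; foldr-preservesʳ; foldr-preservesᵇ; foldr-forcesᵇ)
open import Data.List.Relation.Unary.All as All using (All; []; _∷_; all?)
open import Data.List.Relation.Unary.All.Properties using (¬All⇒Any¬)
open import Data.List.Relation.Unary.AllPairs using ([]; _∷_)
open import Data.List.Relation.Unary.Any as Any using (Any; here; there; index; _─_)
open import Data.List.Relation.Unary.Unique.Propositional using (Unique)
open import Data.Nat
  using (ℕ; zero; suc; _+_; _*_; _^_; _∸_; _≤_; _<_; z≤n; s≤s; _≟_; _≤?_;
         NonZero; nonTrivial⇒n>1; >-nonZero; >-nonZero⁻¹)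
open import Data.Nat.Coprimality as C using (Coprime; coprime-divisor; coprime-Bézout)
open import Data.Nat.DivMod
  using (_%_; _/_; m%n<n; m≡m%n+[m/n]*n; [m+kn]%n≡m%n; m<n⇒m%n≡m; %-distribˡ-*; m%n%n≡m%n; %-remove-+ʳ)
open import Data.Nat.Divisibility
  using (_∣_; divides; _∣?_; ∣⇒≤; ∣-trans; ∣-reflexive; _∣0; 1∣_; ∣1⇒≡1; ∣n⇒∣m*n; ∣m⇒∣m*n;
         *-cancelˡ-∣; *-monoʳ-∣; m%n≡0⇒n∣m; n∣m⇒m%n≡0)
open import Data.Nat.GCD using (module Bézout)
open import Data.Nat.Induction using (<-rec)
open import Data.Nat.ListAction using (product)
open import Data.Nat.ListAction.Properties using (∈⇒∣product; product≢0)
open import Data.Nat.Primality using (Prime; prime⇒nonZero; prime⇒nonTrivial; prime⇒irreducible)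
open import Data.Nat.Properties
  using (≤-refl; ≤-reflexive; ≤-trans; ≤-antisym; ≤-total; ≤-pred; ≤-<-trans; <⇒≤; <⇒≢; <⇒≱; ≰⇒>; ≤∧≢⇒<;
         n≢0⇒n>0; +-identityʳ; +-cancelˡ-≡; +-cancelʳ-≡; *-comm; *-assoc; *-identityʳ; *-mono-≤; m≤m*n;
         m<m*n; m≤n+m; m+[n∸m]≡n; m∸n+n≡m; ^-monoʳ-≤; ^-distribˡ-+-*; m^n>0; m^n≢0;
         m⊓n≤m; m⊓n≤n; ⊓-sel; ⊓-glb)
open import Data.Nat.Tactic.RingSolver using (solve-∀)
open import Data.Product using (Σ; ∃; _×_; _,_; proj₁; proj₂)
open import Data.Product.Properties using (≡-dec)
open import Data.Sum using (_⊎_; inj₁; inj₂; [_,_])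
open import Data.Unit using (⊤; tt)
open import Function.Bundles using (Equivalence; _⇔_; mk⇔)
open import Relation.Binary using (DecidableEquality)
open import Relation.Binary.PropositionalEquality
  using (_≡_; _≢_; refl; sym; trans; subst; subst₂; cong; cong₂; module ≡-Reasoning)
open import Relation.Nullary using (¬_; yes; no)

module _ {A : Set} where

  ∈-─ : ∀ {x y : A} {S} (x∈S : x ∈ S) → y ∈ S → y ≢ x → y ∈ (S ─ x∈S)
  ∈-─ (here refl) (here refl)  y≢x = ⊥-elim (y≢x refl)
  ∈-─ (here refl) (there y∈S)  _   = y∈S
  ∈-─ (there _)   (here refl)  _   = here refl
  ∈-─ (there x∈S) (there y∈S) y≢x = there (∈-─ x∈S y∈S y≢x)

  unique-⊆⇒length-≤ : ∀ {L S : List A} → Unique L → (∀ {w} → w ∈ L → w ∈ S) →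
                      length L ≤ length S
  unique-⊆⇒length-≤ {[]}    _            _    = z≤n
  unique-⊆⇒length-≤ {x ∷ L} {S} (x∉L ∷ uL) L⊆S =
    subst (suc (length L) ≤_) (sym (length-removeAt′ S (index x∈S)))
      (s≤s (unique-⊆⇒length-≤ uL (λ w∈L → ∈-─ x∈S (L⊆S (there w∈L)) (λ w≡x → All.lookup x∉L w∈L (sym w≡x)))))
    where
    x∈S = L⊆S (here refl)

module _ (G : Graph) where
  open Graph G

  neighbours-≤-degree : ∀ {v d} (L : List V) → HasDegree G v d → Unique L →
                        (∀ {w} → w ∈ L → Adj v w) → length L ≤ d
  neighbours-≤-degree L (N , (_ , isN) , refl) uL adj =
    unique-⊆⇒length-≤ uL (λ w∈L → Equivalence.from (isN _) (adj w∈L))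

  twoNeighbours⇒2≤δ : (∀ v → Σ V λ w₁ → Σ V λ w₂ → Adj v w₁ × Adj v w₂ × w₁ ≢ w₂) →
                       ∀ {δ} → IsMinDegree G δ → 2 ≤ δ
  twoNeighbours⇒2≤δ two ((v , deg) , _) with two v
  ... | w₁ , w₂ , a₁ , a₂ , w₁≢w₂ =
    neighbours-≤-degree (w₁ ∷ w₂ ∷ []) deg ((w₁≢w₂ ∷ []) ∷ [] ∷ [])
      (λ { (here refl) → a₁ ; (there (here refl)) → a₂ })

  oneNeighbour⇒1≤δ : (∀ v → Σ V λ w → Adj v w) → ∀ {δ} → IsMinDegree G δ → 1 ≤ δ
  oneNeighbour⇒1≤δ one ((v , deg) , _) =
    neighbours-≤-degree (proj₁ (one v) ∷ []) deg ([] ∷ []) (λ { (here refl) → proj₂ (one v) })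

  module _ (_≟_ : DecidableEquality V) where
    open DecMembership _≟_ using (_∈?_)

    complete⇒survivorUnique : (∀ u w → u ≢ w → Adj u w) → ∀ {S} → IsSeparating G S →
                              ∀ {u w} → u ∉ S → w ∉ S → u ≡ w
    complete⇒survivorUnique _        (_ , inj₂ trivial) u∉S w∉S = trivial _ _ u∉S w∉S
    complete⇒survivorUnique complete (_ , inj₁ (x , y , _ , y∉S , noPath)) _ _ = ⊥-elim (noPath path)
      where
      path : ReachAvoiding G _ x y
      path with x ≟ y
      ... | yes refl = here
      ... | no  x≢y  = step (complete x y x≢y) y∉S here

    -- ... hence κ = δ = |V| − 1: the neighbours of a vertex separate, and a separating set
    -- together with its survivor covers every vertex.
    complete⇒κ≡δ : (∀ {u w} → Adj u w → u ≢ w) → (∀ u w → u ≢ w → Adj u w) →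
                   ∀ {κ δ} → IsVertexConnectivity G κ → IsMinDegree G δ → κ ≡ δ
    complete⇒κ≡δ loopless complete ((S , sepS , refl) , minimal) ((v , N , (uN , isN) , refl) , _) =
      ≤-antisym κ≤δ δ≤κ
      where
      neighbour : ∀ w → v ≢ w → w ∈ N
      neighbour w v≢w = Equivalence.from (isN w) (complete v w v≢w)

      trivialWithoutN : TrivialAfterRemoving G N
      trivialWithoutN u w u∉N w∉N with v ≟ u | v ≟ w
      ... | yes refl | yes refl = refl
      ... | no  v≢u  | _        = ⊥-elim (u∉N (neighbour u v≢u))
      ... | _        | no  v≢w  = ⊥-elim (w∉N (neighbour w v≢w))

      κ≤δ : length S ≤ length N
      κ≤δ = minimal N (uN , inj₂ trivialWithoutN)

      closedNeighbourhood : Unique (v ∷ N)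
      closedNeighbourhood =
        All.tabulate (λ w∈N → loopless (Equivalence.to (isN _) w∈N)) ∷ uN

      δ≤κ : length N ≤ length S
      δ≤κ with all? (_∈? S) (v ∷ N)
      ... | yes allInS = <⇒≤ (unique-⊆⇒length-≤ closedNeighbourhood (All.lookup allInS))
      ... | no notAll with find (¬All⇒Any¬ (_∈? S) (v ∷ N) notAll)
      ...   | s , _ , s∉S = ≤-pred (unique-⊆⇒length-≤ closedNeighbourhood cover)
        where
        cover : ∀ {w} → w ∈ v ∷ N → w ∈ s ∷ S
        cover {w} _ with w ∈? S
        ... | yes w∈S = there w∈S
        ... | no  w∉S = here (complete⇒survivorUnique complete sepS w∉S s∉S)

    dominating⇒connected : (z : V) → (∀ u → u ≢ z → Adj u z × Adj z u) →
                           ∀ u w → ReachAvoiding G [] u w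
    dominating⇒connected z dom u w with u ≟ w | u ≟ z | w ≟ z
    ... | yes refl | _        | _        = here
    ... | no  _    | yes refl | no  w≢z  = step (proj₂ (dom w w≢z)) (λ ()) here
    ... | no  _    | no  u≢z  | yes refl = step (proj₁ (dom u u≢z)) (λ ()) here
    ... | no  _    | no  u≢z  | no  w≢z  =
      step (proj₁ (dom u u≢z)) (λ ()) (step (proj₂ (dom w w≢z)) (λ ()) here)
    ... | no  u≢w  | yes refl | yes refl = ⊥-elim (u≢w refl)

    dominating⇒1≤κ : (z : V) → (∀ u → u ≢ z → Adj u z × Adj z u) → (u w : V) → u ≢ w →
                     ∀ {κ} → IsVertexConnectivity G κ → 1 ≤ κ
    dominating⇒1≤κ z dom u w u≢w ((S , sepS , refl) , _) = nonEmpty S sepS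
      where
      nonEmpty : ∀ S → IsSeparating G S → 1 ≤ length S
      nonEmpty (_ ∷ _) _                                = s≤s z≤n
      nonEmpty []      (_ , inj₁ (x , y , _ , _ , noPath)) = ⊥-elim (noPath (dominating⇒connected z dom x y))
      nonEmpty []      (_ , inj₂ trivial)               = ⊥-elim (u≢w (trivial u w (λ ()) (λ ())))

-- Scalar multiplication in Z/n₁ × ⋯ × Z/nᵣ

infixr 7 _·ᶠ_
_·ᶠ_ : ∀ {n} → ℕ → Fin n → Fin n
_·ᶠ_ {suc k} m u = fromℕ< (m%n<n (m * toℕ u) (suc k))

toℕ-·ᶠ : ∀ {k} m (u : Fin (suc k)) → toℕ (m ·ᶠ u) ≡ (m * toℕ u) % suc k
toℕ-·ᶠ m u = toℕ-fromℕ< _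

·ᶠ-isMultiple : ∀ {n} m (u : Fin n) → ∃ λ t → m * toℕ u ≡ toℕ (m ·ᶠ u) + t * n
·ᶠ-isMultiple {suc k} m u =
  m * toℕ u / suc k , trans (m≡m%n+[m/n]*n (m * toℕ u) (suc k)) (cong (_+ (m * toℕ u / suc k) * suc k) (sym (toℕ-·ᶠ m u)))

isMultiple⇒·ᶠ : ∀ {n} m (u v : Fin n) → (∃ λ t → m * toℕ u ≡ toℕ v + t * n) → v ≡ m ·ᶠ u
isMultiple⇒·ᶠ {suc k} m u v (t , eq) = toℕ-injective (begin
  toℕ v                        ≡⟨ sym (m<n⇒m%n≡m (toℕ<n v)) ⟩
  toℕ v % suc k                ≡⟨ sym ([m+kn]%n≡m%n (toℕ v) t (suc k)) ⟩
  (toℕ v + t * suc k) % suc k  ≡⟨ cong (_% suc k) (sym eq) ⟩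
  (m * toℕ u) % suc k          ≡⟨ sym (toℕ-·ᶠ m u) ⟩
  toℕ (m ·ᶠ u)                 ∎)
  where open ≡-Reasoning

·ᶠ-assoc : ∀ {n} a b (u : Fin n) → a ·ᶠ b ·ᶠ u ≡ (a * b) ·ᶠ u
·ᶠ-assoc {suc k} a b u = toℕ-injective (begin
  toℕ (a ·ᶠ b ·ᶠ u)                             ≡⟨ toℕ-·ᶠ a (b ·ᶠ u) ⟩
  (a * toℕ (b ·ᶠ u)) % n                        ≡⟨ cong (λ r → (a * r) % n) (toℕ-·ᶠ b u) ⟩
  (a * ((b * toℕ u) % n)) % n                   ≡⟨ %-distribʳ-* a ((b * toℕ u) % n) ⟩
  (a * ((b * toℕ u) % n % n)) % n               ≡⟨ cong (λ r → (a * r) % n) (m%n%n≡m%n (b * toℕ u) n) ⟩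
  (a * ((b * toℕ u) % n)) % n                   ≡⟨ sym (%-distribʳ-* a (b * toℕ u)) ⟩
  (a * (b * toℕ u)) % n                         ≡⟨ cong (_% n) (sym (*-assoc a b (toℕ u))) ⟩
  (a * b * toℕ u) % n                           ≡⟨ sym (toℕ-·ᶠ (a * b) u) ⟩
  toℕ ((a * b) ·ᶠ u)                            ∎)
  where
  n = suc k
  open ≡-Reasoning
  %-distribʳ-* : ∀ x y → (x * y) % n ≡ (x * (y % n)) % n
  %-distribʳ-* x y = begin
    (x * y) % n                   ≡⟨ %-distribˡ-* x y n ⟩
    ((x % n) * (y % n)) % n       ≡⟨ cong (λ r → ((x % n) * r) % n) (sym (m%n%n≡m%n y n)) ⟩
    ((x % n) * (y % n % n)) % n   ≡⟨ sym (%-distribˡ-* x (y % n) n) ⟩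
    (x * (y % n)) % n             ∎

·ᶠ-identity : ∀ {n} (u : Fin n) → 1 ·ᶠ u ≡ u
·ᶠ-identity {suc k} u = sym (isMultiple⇒·ᶠ 1 u u (0 , refl))

∣-residue⇒0 : ∀ {n} (u : Fin n) → n ∣ toℕ u → toℕ u ≡ 0
∣-residue⇒0 u n∣u with toℕ u | toℕ<n u
... | zero  | _   = refl
... | suc r | r<n = ⊥-elim (<⇒≱ r<n (∣⇒≤ n∣u))

·ᶠ≡0⇒∣ : ∀ {n} m (u : Fin n) → toℕ (m ·ᶠ u) ≡ 0 → n ∣ m * toℕ u
·ᶠ≡0⇒∣ {suc k} m u eq = m%n≡0⇒n∣m (m * toℕ u) (suc k) (trans (sym (toℕ-·ᶠ m u)) eq)

∣⇒·ᶠ≡0 : ∀ {n} m (u : Fin n) → n ∣ m * toℕ u → toℕ (m ·ᶠ u) ≡ 0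
∣⇒·ᶠ≡0 {suc k} m u n∣mu = trans (toℕ-·ᶠ m u) (n∣m⇒m%n≡0 (m * toℕ u) (suc k) n∣mu)

·ᶠ-periodic : ∀ {n} K a c (u : Fin n) → n ∣ K * toℕ u → (a + c * K) ·ᶠ u ≡ a ·ᶠ u
·ᶠ-periodic {suc k} K a c u n∣Ku = toℕ-injective (begin
  toℕ ((a + c * K) ·ᶠ u)                  ≡⟨ toℕ-·ᶠ (a + c * K) u ⟩
  ((a + c * K) * toℕ u) % suc k           ≡⟨ cong (_% suc k) (expand a c K (toℕ u)) ⟩
  (a * toℕ u + c * (K * toℕ u)) % suc k   ≡⟨ %-remove-+ʳ (a * toℕ u) (∣n⇒∣m*n c n∣Ku) ⟩
  (a * toℕ u) % suc k                     ≡⟨ sym (toℕ-·ᶠ a u) ⟩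
  toℕ (a ·ᶠ u)                            ∎)
  where
  open ≡-Reasoning
  expand : ∀ a c K x → (a + c * K) * x ≡ a * x + c * (K * x)
  expand = solve-∀

2·ᶠ-fixed⇒0 : ∀ {n} (u : Fin n) → 2 ·ᶠ u ≡ u → toℕ u ≡ 0
2·ᶠ-fixed⇒0 {n} u 2u≡u with ·ᶠ-isMultiple 2 u
... | t , eq = ∣-residue⇒0 u (divides t (+-cancelˡ-≡ (toℕ u) (toℕ u) (t * n) (begin
  toℕ u + toℕ u              ≡⟨ cong (toℕ u +_) (sym (+-identityʳ (toℕ u))) ⟩
  2 * toℕ u                  ≡⟨ eq ⟩
  toℕ (2 ·ᶠ u) + t * n       ≡⟨ cong (λ v → toℕ v + t * n) 2u≡u ⟩
  toℕ u + t * n              ∎)))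
  where open ≡-Reasoning

even⇒halvable : ∀ {n} (c : Fin n) → 2 ∣ toℕ c → ∃ λ h → 2 ·ᶠ h ≡ c
even⇒halvable c (divides q c≡q*2) = fromℕ< q<n , sym (isMultiple⇒·ᶠ 2 (fromℕ< q<n) c (0 , (begin
  2 * toℕ (fromℕ< q<n)   ≡⟨ cong (2 *_) (toℕ-fromℕ< q<n) ⟩
  2 * q                  ≡⟨ *-comm 2 q ⟩
  q * 2                  ≡⟨ sym c≡q*2 ⟩
  toℕ c                  ≡⟨ sym (+-identityʳ (toℕ c)) ⟩
  toℕ c + 0              ∎)))
  where
  open ≡-Reasoning
  q<n = ≤-<-trans (subst (q ≤_) (sym c≡q*2) (m≤m*n q 2)) (toℕ<n c)

·ᶠ-zero : ∀ {n} m (u : Fin n) → toℕ u ≡ 0 → toℕ (m ·ᶠ u) ≡ 0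
·ᶠ-zero {n} m u u≡0 = ∣⇒·ᶠ≡0 m u (∣n⇒∣m*n m (subst (n ∣_) (sym u≡0) (n ∣0)))

scale : ∀ ns → ℕ → Elem ns → Elem ns
scale []       _ _        = tt
scale (_ ∷ ns) m (u , us) = m ·ᶠ u , scale ns m us

scale-isMultiple : ∀ ns m x → IsMultiple ns m x (scale ns m x)
scale-isMultiple []       m _        = tt
scale-isMultiple (_ ∷ ns) m (u , us) = ·ᶠ-isMultiple m u , scale-isMultiple ns m us

isMultiple⇒scale : ∀ ns m x y → IsMultiple ns m x y → y ≡ scale ns m x
isMultiple⇒scale []       m _        _        _          = refl
isMultiple⇒scale (_ ∷ ns) m (u , us) (v , vs) (uv , usvs) =
  cong₂ _,_ (isMultiple⇒·ᶠ m u v uv) (isMultiple⇒scale ns m us vs usvs)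

scale-isPowerOf : ∀ ns m x → 1 ≤ m → IsPowerOf ns x (scale ns m x)
scale-isPowerOf ns m x 1≤m = m , 1≤m , scale-isMultiple ns m x

isPowerOf⇒scale : ∀ ns x y → IsPowerOf ns x y → ∃ λ m → 1 ≤ m × y ≡ scale ns m x
isPowerOf⇒scale ns x y (m , 1≤m , mx≡y) = m , 1≤m , isMultiple⇒scale ns m x y mx≡y

scale-assoc : ∀ ns a b x → scale ns a (scale ns b x) ≡ scale ns (a * b) x
scale-assoc []       a b _        = refl
scale-assoc (_ ∷ ns) a b (u , us) = cong₂ _,_ (·ᶠ-assoc a b u) (scale-assoc ns a b us)

scale-comm : ∀ ns a b x → scale ns a (scale ns b x) ≡ scale ns b (scale ns a x)
scale-comm ns a b x = begin
  scale ns a (scale ns b x)  ≡⟨ scale-assoc ns a b x ⟩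
  scale ns (a * b) x         ≡⟨ cong (λ m → scale ns m x) (*-comm a b) ⟩
  scale ns (b * a) x         ≡⟨ sym (scale-assoc ns b a x) ⟩
  scale ns b (scale ns a x)  ∎
  where open ≡-Reasoning

scale-identity : ∀ ns x → scale ns 1 x ≡ x
scale-identity []       _        = refl
scale-identity (_ ∷ ns) (u , us) = cong₂ _,_ (·ᶠ-identity u) (scale-identity ns us)

infix 4 _≟ᴱ_
_≟ᴱ_ : ∀ {ns} → DecidableEquality (Elem ns)
_≟ᴱ_ {[]}     tt tt = yes refl
_≟ᴱ_ {_ ∷ ns} = ≡-dec _≟ᶠ_ _≟ᴱ_

Pos : List ℕ → Set
Pos = All (1 ≤_)

0ᴱ : ∀ ns → Pos ns → Elem ns
0ᴱ []       _           = tt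
0ᴱ (_ ∷ ns) (0<n ∷ pos) = fromℕ< 0<n , 0ᴱ ns pos

IsZero : ∀ ns → Elem ns → Set
IsZero []       _        = ⊤
IsZero (_ ∷ ns) (u , us) = toℕ u ≡ 0 × IsZero ns us

isZero⇒≡0ᴱ : ∀ ns pos x → IsZero ns x → x ≡ 0ᴱ ns pos
isZero⇒≡0ᴱ []       _           _        _            = refl
isZero⇒≡0ᴱ (_ ∷ ns) (0<n ∷ pos) (u , us) (u≡0 , us≡0) =
  cong₂ _,_ (toℕ-injective (trans u≡0 (sym (toℕ-fromℕ< 0<n)))) (isZero⇒≡0ᴱ ns pos us us≡0)

≡0ᴱ⇒isZero : ∀ ns pos x → x ≡ 0ᴱ ns pos → IsZero ns x
≡0ᴱ⇒isZero []       _           _ _    = tt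
≡0ᴱ⇒isZero (_ ∷ ns) (0<n ∷ pos) _ refl = toℕ-fromℕ< 0<n , ≡0ᴱ⇒isZero ns pos _ refl

scale-zeroʳ : ∀ ns pos m → scale ns m (0ᴱ ns pos) ≡ 0ᴱ ns pos
scale-zeroʳ ns pos m = isZero⇒≡0ᴱ ns pos _ (go ns pos)
  where
  go : ∀ ns pos → IsZero ns (scale ns m (0ᴱ ns pos))
  go []       _           = tt
  go (_ ∷ ns) (0<n ∷ pos) = ·ᶠ-zero m (fromℕ< 0<n) (toℕ-fromℕ< 0<n) , go ns pos

scale-annihilated : ∀ ns pos K → All (_∣ K) ns → ∀ x → scale ns K x ≡ 0ᴱ ns pos
scale-annihilated ns pos K ns∣K x = isZero⇒≡0ᴱ ns pos _ (go ns ns∣K x)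
  where
  go : ∀ ns → All (_∣ K) ns → ∀ x → IsZero ns (scale ns K x)
  go []       _              _        = tt
  go (_ ∷ ns) (n∣K ∷ ns∣K) (u , us) = ∣⇒·ᶠ≡0 K u (∣m⇒∣m*n (toℕ u) n∣K) , go ns ns∣K us

scale-periodic : ∀ ns pos K a c x → scale ns K x ≡ 0ᴱ ns pos → scale ns (a + c * K) x ≡ scale ns a x
scale-periodic ns pos K a c x Kx≡0 = go ns x (≡0ᴱ⇒isZero ns pos _ Kx≡0)
  where
  go : ∀ ns x → IsZero ns (scale ns K x) → scale ns (a + c * K) x ≡ scale ns a x
  go []       _        _                = refl
  go (_ ∷ ns) (u , us) (Ku≡0 , Kus≡0) =
    cong₂ _,_ (·ᶠ-periodic K a c u (·ᶠ≡0⇒∣ K u Ku≡0)) (go ns us Kus≡0)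

2-fixed⇒0 : ∀ ns pos x → scale ns 2 x ≡ x → x ≡ 0ᴱ ns pos
2-fixed⇒0 ns pos x 2x≡x = isZero⇒≡0ᴱ ns pos x (go ns x 2x≡x)
  where
  go : ∀ ns x → scale ns 2 x ≡ x → IsZero ns x
  go []       _        _    = tt
  go (_ ∷ ns) (u , us) 2x≡x = 2·ᶠ-fixed⇒0 u (cong proj₁ 2x≡x) , go ns us (cong proj₂ 2x≡x)

-- Arithmetic modulo powers of a prime

MultipleMod : ℕ → ℕ → ℕ → Set
MultipleMod N x y = ∃ λ m → 1 ≤ m × ∃ λ t → m * x ≡ y + t * N

inverse-mod : ∀ {u N} → Coprime u N → 2 ≤ N → ∃ λ w → ∃ λ c → w * u ≡ 1 + c * N
inverse-mod {u} {N} u⊥N 2≤N with coprime-Bézout u⊥N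
... | Bézout.+- x y 1+yN≡xu = x , y , sym 1+yN≡xu
... | Bézout.-+ x y 1+xu≡yN = negate N 2≤N y 1+xu≡yN
  where
  -- from x * u ≡ −1 (mod N), the inverse is (N − 1) * x
  negate : ∀ N → 2 ≤ N → ∀ y → 1 + x * u ≡ y * N → ∃ λ w → ∃ λ c → w * u ≡ 1 + c * N
  negate (suc zero)    (s≤s ())
  negate (suc (suc M)) _ zero    ()
  negate (suc (suc M)) _ (suc y) eq =
    suc M * x , y + M * suc y , +-cancelʳ-≡ (suc M) _ _ (begin
      suc M * x * u + suc M                         ≡⟨ factor (suc M) x u ⟩
      suc M * (1 + x * u)                           ≡⟨ cong (suc M *_) eq ⟩
      suc M * (suc y * suc (suc M))                 ≡⟨ expand M y ⟩
      1 + (y + M * suc y) * suc (suc M) + suc M     ∎)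
    where
    open ≡-Reasoning
    factor : ∀ M x u → M * x * u + M ≡ M * (1 + x * u)
    factor = solve-∀
    expand : ∀ M y → suc M * (suc y * suc (suc M)) ≡ 1 + (y + M * suc y) * suc (suc M) + suc M
    expand = solve-∀

module PrimeModuli {p : ℕ} (p-prime : Prime p) where

  instance
    p≢0 : NonZero p
    p≢0 = prime⇒nonZero p-prime

  1<p : 1 < p
  1<p = nonTrivial⇒n>1 p {{prime⇒nonTrivial p-prime}}

  coprime-power : ∀ {u} → ¬ p ∣ u → ∀ a → Coprime u (p ^ a)
  coprime-power p∤u zero    (_ , d∣1)      = ∣1⇒≡1 d∣1
  coprime-power {u} p∤u (suc a) {d} (d∣u , d∣pᵃ⁺¹) =
    coprime-power p∤u a (d∣u , coprime-divisor d⊥p d∣pᵃ⁺¹)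
    where
    d⊥p : Coprime d p
    d⊥p (e∣d , e∣p) with prime⇒irreducible p-prime e∣p
    ... | inj₁ e≡1    = e≡1
    ... | inj₂ refl   = ⊥-elim (p∤u (∣-trans e∣d d∣u))

  unit-cancel : ∀ {u} → ¬ p ∣ u → ∀ a c → p ^ a ∣ u * c → p ^ a ∣ c
  unit-cancel p∤u a c = coprime-divisor (C.sym (coprime-power p∤u a))

  PAdic : ℕ → Set
  PAdic m = 0 < m → ∃ λ u → ∃ λ t → m ≡ u * p ^ t × ¬ p ∣ u

  p-adic : ∀ m → PAdic m
  p-adic = <-rec PAdic decompose
    where
    decompose : ∀ m → (∀ {k} → k < m → PAdic k) → PAdic m
    decompose m rec 0<m with p ∣? m
    ... | no  p∤m                = m , 0 , sym (*-identityʳ m) , p∤m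
    ... | yes (divides q m≡q*p) with rec q<m 0<q
      where
      0<q : 0 < q
      0<q = n≢0⇒n>0 (λ q≡0 → <⇒≢ 0<m (sym (trans m≡q*p (cong (_* p) q≡0))))
      q<m : q < m
      q<m = subst (q <_) (sym m≡q*p) (m<m*n q p {{>-nonZero 0<q}} 1<p)
    ...   | u , t , q≡u*pᵗ , p∤u = u , suc t , m≡u*pᵗ⁺¹ , p∤u
      where
      m≡u*pᵗ⁺¹ : m ≡ u * p ^ suc t
      m≡u*pᵗ⁺¹ = trans m≡q*p (trans (cong (_* p) q≡u*pᵗ) (shift u (p ^ t) p))
        where
        shift : ∀ u P p → u * P * p ≡ u * (p * P)
        shift = solve-∀

  -- modulo p ^ a, the number u * p ^ s (p ∤ u) has every v * p ^ (s + d) as a positive multiple: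
  -- multiply by p ^ d * v * u⁻¹
  towards : ∀ a → 1 ≤ a → ∀ {u} s v d → ¬ p ∣ u → MultipleMod (p ^ a) (u * p ^ s) (v * p ^ (s + d))
  towards a 1≤a {u} s v d p∤u with inverse-mod (coprime-power p∤u a) 2≤N
    where 2≤N = ≤-trans 1<p (subst (_≤ p ^ a) (*-identityʳ p) (^-monoʳ-≤ p 1≤a))
  ... | w , c , wu≡1+cN =
    D * v * w + N , ≤-trans (m^n>0 p a) (m≤n+m N (D * v * w)) , v * p ^ (s + d) * c + u * S , (begin
      (D * v * w + N) * (u * S)             ≡⟨ distribute D v w N u S ⟩
      D * v * S * (w * u) + N * (u * S)     ≡⟨ cong (λ r → D * v * S * r + N * (u * S)) wu≡1+cN ⟩
      D * v * S * (1 + c * N) + N * (u * S) ≡⟨ collect D v S c N u ⟩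
      v * (S * D) + (v * (S * D) * c + u * S) * N
                                            ≡⟨ cong (λ r → v * r + (v * r * c + u * S) * N) (sym (^-distribˡ-+-* p s d)) ⟩
      v * p ^ (s + d) + (v * p ^ (s + d) * c + u * S) * N ∎)
    where
    open ≡-Reasoning
    D = p ^ d
    S = p ^ s
    N = p ^ a
    distribute : ∀ D v w N u S → (D * v * w + N) * (u * S) ≡ D * v * S * (w * u) + N * (u * S)
    distribute = solve-∀
    collect : ∀ D v S c N u → D * v * S * (1 + c * N) + N * (u * S) ≡ v * (S * D) + (v * (S * D) * c + u * S) * N
    collect = solve-∀

  towards-≤ : ∀ a → 1 ≤ a → ∀ {u} v {s r} → ¬ p ∣ u → s ≤ r → MultipleMod (p ^ a) (u * p ^ s) (v * p ^ r)
  towards-≤ a 1≤a v {s} p∤u s≤r =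
    subst (λ r → MultipleMod (p ^ a) _ (v * p ^ r)) (m+[n∸m]≡n s≤r) (towards a 1≤a s v _ p∤u)

  cyclic-comparable : ∀ a → 1 ≤ a → ∀ x y → MultipleMod (p ^ a) x y ⊎ MultipleMod (p ^ a) y x
  cyclic-comparable a 1≤a zero    y       = inj₂ (p ^ a , m^n>0 p a , y , *-comm (p ^ a) y)
  cyclic-comparable a 1≤a (suc x) zero    = inj₁ (p ^ a , m^n>0 p a , suc x , *-comm (p ^ a) (suc x))
  cyclic-comparable a 1≤a (suc x) (suc y)
    with p-adic (suc x) (s≤s z≤n) | p-adic (suc y) (s≤s z≤n)
  ... | u , s , x≡u*pˢ , p∤u | v , r , y≡v*pʳ , p∤v with ≤-total s r
  ... | inj₁ s≤r = inj₁ (subst₂ (MultipleMod (p ^ a)) (sym x≡u*pˢ) (sym y≡v*pʳ) (towards-≤ a 1≤a v p∤u s≤r))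
  ... | inj₂ r≤s = inj₂ (subst₂ (MultipleMod (p ^ a)) (sym y≡v*pʳ) (sym x≡u*pˢ) (towards-≤ a 1≤a u p∤v r≤s))

-- Vertices and neighbours in the power graph of Z/n₁ × ⋯ × Z/nᵣ

module PowerGraph (ns : List ℕ) (pos : Pos ns) where
  open Graph (PowerGraphProd ns)

  0ᴳ : Elem ns
  0ᴳ = 0ᴱ ns pos

  infixr 7 _·_
  _·_ : ℕ → Elem ns → Elem ns
  _·_ = scale ns

  ·-zeroʳ : ∀ m → m · 0ᴳ ≡ 0ᴳ
  ·-zeroʳ = scale-zeroʳ ns pos

  multiple-adj : ∀ {m} x → 1 ≤ m → x ≢ m · x → Adj x (m · x) × Adj (m · x) x
  multiple-adj {m} x 1≤m x≢mx =
    (x≢mx , inj₁ (scale-isPowerOf ns m x 1≤m)) , ((λ e → x≢mx (sym e)) , inj₂ (scale-isPowerOf ns m x 1≤m))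

  -- N = n₁ ⋯ nᵣ annihilates everything, so 0 is adjacent to every other vertex
  zero-dominates : ∀ u → u ≢ 0ᴳ → Adj u 0ᴳ × Adj 0ᴳ u
  zero-dominates u u≢0 =
    subst (λ z → Adj u z × Adj z u) Nu≡0 (multiple-adj u 1≤N (λ u≡Nu → u≢0 (trans u≡Nu Nu≡0)))
    where
    N = product ns
    1≤N : 1 ≤ N
    1≤N = >-nonZero⁻¹ N {{product≢0 (All.map >-nonZero pos)}}
    Nu≡0 : N · u ≡ 0ᴳ
    Nu≡0 = scale-annihilated ns pos N (All.tabulate ∈⇒∣product) u

  nonzero⇒1≤δ : ∀ e → e ≢ 0ᴳ → ∀ {δ} → IsMinDegree (PowerGraphProd ns) δ → 1 ≤ δ
  nonzero⇒1≤δ e e≢0 = oneNeighbour⇒1≤δ (PowerGraphProd ns) neighbour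
    where
    neighbour : ∀ v → Σ (Elem ns) λ w → Adj v w
    neighbour v with v ≟ᴱ 0ᴳ
    ... | yes refl = e , proj₂ (zero-dominates e e≢0)
    ... | no  v≢0  = 0ᴳ , proj₁ (zero-dominates v v≢0)

  HalvesTwoTorsion : Set
  HalvesTwoTorsion = ∀ v → 2 · v ≡ 0ᴳ → ∃ λ w → 2 · w ≡ v

  -- then every nonzero v has a neighbour besides 0: its double, or a half of it if 2·v = 0
  nonzeroNeighbour : HalvesTwoTorsion → ∀ v → v ≢ 0ᴳ → Σ (Elem ns) λ y → Adj v y × y ≢ 0ᴳ
  nonzeroNeighbour halve v v≢0 with 2 · v ≟ᴱ 0ᴳ
  ... | no 2v≢0  = 2 · v , proj₁ (multiple-adj v (s≤s z≤n) (λ e → v≢0 (2-fixed⇒0 ns pos v (sym e)))) , 2v≢0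
  ... | yes 2v≡0 with halve v 2v≡0
  ...   | w , 2w≡v = w , subst (λ z → Adj z w) 2w≡v (proj₂ (multiple-adj w (s≤s z≤n) w≢2w)) , w≢0
    where
    w≢0 : w ≢ 0ᴳ
    w≢0 refl = v≢0 (trans (sym 2w≡v) (·-zeroʳ 2))
    w≢2w : w ≢ 2 · w
    w≢2w e = w≢0 (2-fixed⇒0 ns pos w (sym e))

  halvable⇒2≤δ : HalvesTwoTorsion → ∀ e₁ e₂ → e₁ ≢ 0ᴳ → e₂ ≢ 0ᴳ → e₁ ≢ e₂ →
                 ∀ {δ} → IsMinDegree (PowerGraphProd ns) δ → 2 ≤ δ
  halvable⇒2≤δ halve e₁ e₂ e₁≢0 e₂≢0 e₁≢e₂ = twoNeighbours⇒2≤δ (PowerGraphProd ns) two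
    where
    two : ∀ v → Σ (Elem ns) λ w₁ → Σ (Elem ns) λ w₂ → Adj v w₁ × Adj v w₂ × w₁ ≢ w₂
    two v with v ≟ᴱ 0ᴳ
    ... | yes refl = e₁ , e₂ , proj₂ (zero-dominates e₁ e₁≢0) , proj₂ (zero-dominates e₂ e₂≢0) , e₁≢e₂
    ... | no  v≢0  with nonzeroNeighbour halve v v≢0
    ...   | y , v~y , y≢0 = 0ᴳ , y , proj₁ (zero-dominates v v≢0) , v~y , (λ 0≡y → y≢0 (sym 0≡y))

  zeroSeparates⇒κ≡1 : IsSeparating (PowerGraphProd ns) (0ᴳ ∷ []) → ∀ e₁ e₂ → e₁ ≢ e₂ →
                      ∀ {κ} → IsVertexConnectivity (PowerGraphProd ns) κ → κ ≡ 1
  zeroSeparates⇒κ≡1 sep e₁ e₂ e₁≢e₂ vc@(_ , minimal) =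
    ≤-antisym (minimal (0ᴳ ∷ []) sep) (dominating⇒1≤κ (PowerGraphProd ns) _≟ᴱ_ 0ᴳ zero-dominates e₁ e₂ e₁≢e₂ vc)

  odd-on-2torsion : ∀ {m} x → ¬ 2 ∣ m → 2 · x ≡ 0ᴳ → m · x ≡ x
  odd-on-2torsion {m} x 2∤m 2x≡0 = begin
    m · x                     ≡⟨ cong (_· x) (m≡m%n+[m/n]*n m 2) ⟩
    (m % 2 + m / 2 * 2) · x   ≡⟨ scale-periodic ns pos 2 (m % 2) (m / 2) x 2x≡0 ⟩
    (m % 2) · x               ≡⟨ cong (_· x) m%2≡1 ⟩
    1 · x                     ≡⟨ scale-identity ns x ⟩
    x                         ∎
    where
    open ≡-Reasoning
    m%2≡1 : m % 2 ≡ 1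
    m%2≡1 with m % 2 | m%n<n m 2 | m%n≡0⇒n∣m m 2
    ... | zero        | _             | 2∣m = ⊥-elim (2∤m (2∣m refl))
    ... | suc zero    | _             | _   = refl
    ... | suc (suc _) | s≤s (s≤s ()) | _

  even-on-2torsion : ∀ q x → 2 · x ≡ 0ᴳ → (q * 2) · x ≡ 0ᴳ
  even-on-2torsion q x 2x≡0 = begin
    (q * 2) · x   ≡⟨ sym (scale-assoc ns q 2 x) ⟩
    q · 2 · x     ≡⟨ cong (q ·_) 2x≡0 ⟩
    q · 0ᴳ        ≡⟨ ·-zeroʳ q ⟩
    0ᴳ            ∎
    where open ≡-Reasoning

  even-is-double : ∀ q x → (q * 2) · x ≡ 2 · q · x
  even-is-double q x = trans (cong (_· x) (*-comm q 2)) (sym (scale-assoc ns 2 q x))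

-- Finite abelian p-groups Z/p^a₁ × ⋯ × Z/p^aᵣ

module PGroup {p : ℕ} (p-prime : Prime p) where
  open PrimeModuli p-prime

  pows : List ℕ → List ℕ
  pows = map (p ^_)

  pows-pos : ∀ as → Pos (pows as)
  pows-pos []       = []
  pows-pos (a ∷ as) = m^n>0 p a ∷ pows-pos as

  unit-·ᶠ≡0 : ∀ {u} → ¬ p ∣ u → ∀ a (c : Fin (p ^ a)) → toℕ (u ·ᶠ c) ≡ 0 → toℕ c ≡ 0
  unit-·ᶠ≡0 p∤u a c uc≡0 = ∣-residue⇒0 c (unit-cancel p∤u a (toℕ c) (·ᶠ≡0⇒∣ _ c uc≡0))

  unit-cancelᴱ : ∀ {u} → ¬ p ∣ u → ∀ as x → scale (pows as) u x ≡ 0ᴱ (pows as) (pows-pos as) →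
                 x ≡ 0ᴱ (pows as) (pows-pos as)
  unit-cancelᴱ {u} p∤u as x ux≡0 =
    isZero⇒≡0ᴱ (pows as) (pows-pos as) x (go as x (≡0ᴱ⇒isZero (pows as) (pows-pos as) _ ux≡0))
    where
    go : ∀ as x → IsZero (pows as) (scale (pows as) u x) → IsZero (pows as) x
    go []       _        _                = tt
    go (a ∷ as) (c , cs) (uc≡0 , ucs≡0) = unit-·ᶠ≡0 p∤u a c uc≡0 , go as cs ucs≡0

  -- for odd p there is no element of order 2, so 2-torsion is trivially halvable
  odd⇒halvable : p ≢ 2 → ∀ as → PowerGraph.HalvesTwoTorsion (pows as) (pows-pos as)
  odd⇒halvable p≢2 as v 2v≡0 = 0ᴱ (pows as) (pows-pos as) ,
    trans (scale-zeroʳ (pows as) (pows-pos as) 2) (sym (unit-cancelᴱ p∤2 as v 2v≡0))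
    where
    p∤2 : ¬ p ∣ 2
    p∤2 p∣2 = p≢2 (≤-antisym (∣⇒≤ p∣2) 1<p)

  2-torsion-even : ∀ a → 2 ≤ a → (c : Fin (2 ^ a)) → 2 ^ a ∣ 2 * toℕ c → 2 ∣ toℕ c
  2-torsion-even (suc zero)    (s≤s ())
  2-torsion-even (suc (suc b)) _ c 2ᵃ∣2c =
    ∣-trans (divides (2 ^ b) (*-comm 2 (2 ^ b))) (*-cancelˡ-∣ 2 2ᵃ∣2c)

  two⇒halvable : p ≡ 2 → ∀ as → All (2 ≤_) as → PowerGraph.HalvesTwoTorsion (pows as) (pows-pos as)
  two⇒halvable refl as 2≤as v 2v≡0 = go as 2≤as v (≡0ᴱ⇒isZero (pows as) (pows-pos as) _ 2v≡0)
    where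
    go : ∀ as → All (2 ≤_) as → ∀ v → IsZero (pows as) (scale (pows as) 2 v) →
         ∃ λ w → scale (pows as) 2 w ≡ v
    go []       _            _        _                = tt , refl
    go (a ∷ as) (2≤a ∷ 2≤as) (c , cs) (2c≡0 , 2cs≡0) with even⇒halvable c (2-torsion-even a 2≤a c (·ᶠ≡0⇒∣ 2 c 2c≡0))
                                                         | go as 2≤as cs 2cs≡0
    ... | h , 2h≡c | hs , 2hs≡cs = (h , hs) , cong₂ _,_ 2h≡c 2hs≡cs

  -- The invariant that disconnects the power graph of a non-cyclic p-group once 0 is removed.
  -- For x ≠ 0, let p^s·x be the multiple of x of order p; HeadSocle x says that it has a
  -- nonzero first coordinate.  Units preserve and reflect it; multiplication by p^t reflects it
  -- and preserves it as long as the result is nonzero; so it is constant along paths avoiding 0.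
  module Socle (a : ℕ) (as : List ℕ) where
    open PowerGraph (pows (a ∷ as)) (pows-pos (a ∷ as))
    open Graph (PowerGraphProd (pows (a ∷ as))) using (V; Adj)

    head : V → ℕ
    head x = toℕ (proj₁ x)

    HeadSocle : V → Set
    HeadSocle x = ∃ λ s → p ^ suc s · x ≡ 0ᴳ × head (p ^ s · x) ≢ 0

    unit-preserves : ∀ {u} x → ¬ p ∣ u → HeadSocle x → HeadSocle (u · x)
    unit-preserves {u} x p∤u (s , pˢ⁺¹x≡0 , hd≢0) = s , (begin
      p ^ suc s · u · x   ≡⟨ scale-comm _ (p ^ suc s) u x ⟩
      u · p ^ suc s · x   ≡⟨ cong (u ·_) pˢ⁺¹x≡0 ⟩
      u · 0ᴳ              ≡⟨ ·-zeroʳ u ⟩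
      0ᴳ                  ∎) ,
      λ hd≡0 → hd≢0 (unit-·ᶠ≡0 p∤u a _ (trans (cong head (scale-comm _ u (p ^ s) x)) hd≡0))
      where open ≡-Reasoning

    unit-reflects : ∀ {u} x → ¬ p ∣ u → HeadSocle (u · x) → HeadSocle x
    unit-reflects {u} x p∤u (s , pˢ⁺¹ux≡0 , hd≢0) =
      s , unit-cancelᴱ p∤u (a ∷ as) _ (trans (scale-comm _ u (p ^ suc s) x) pˢ⁺¹ux≡0) ,
      λ hd≡0 → hd≢0 (trans (cong head (scale-comm _ (p ^ s) u x)) (·ᶠ-zero u _ hd≡0))

    pow-pow : ∀ i j x → p ^ i · p ^ j · x ≡ p ^ (i + j) · x
    pow-pow i j x = trans (scale-assoc _ (p ^ i) (p ^ j) x) (cong (_· x) (sym (^-distribˡ-+-* p i j)))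

    power-reflects : ∀ t x → HeadSocle (p ^ t · x) → HeadSocle x
    power-reflects t x (s , pˢ⁺¹pᵗx≡0 , hd≢0) =
      s + t , trans (sym (pow-pow (suc s) t x)) pˢ⁺¹pᵗx≡0 , λ hd≡0 → hd≢0 (trans (cong head (pow-pow s t x)) hd≡0)

    power-preserves : ∀ t x → p ^ t · x ≢ 0ᴳ → HeadSocle x → HeadSocle (p ^ t · x)
    power-preserves t x pᵗx≢0 (s , pˢ⁺¹x≡0 , hd≢0) with t ≤? s
    ... | yes t≤s = s ∸ t ,
      trans (pow-pow (suc (s ∸ t)) t x) (trans (cong (λ e → p ^ suc e · x) (m∸n+n≡m t≤s)) pˢ⁺¹x≡0) ,
      λ hd≡0 → hd≢0 (trans (cong (λ e → head (p ^ e · x)) (sym (m∸n+n≡m t≤s)))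
                           (trans (cong head (sym (pow-pow (s ∸ t) t x))) hd≡0))
    ... | no  t≰s = ⊥-elim (pᵗx≢0 (begin
      p ^ t · x                         ≡⟨ cong (λ e → p ^ e · x) (sym (m∸n+n≡m s<t)) ⟩
      p ^ (t ∸ suc s + suc s) · x       ≡⟨ sym (pow-pow (t ∸ suc s) (suc s) x) ⟩
      p ^ (t ∸ suc s) · p ^ suc s · x   ≡⟨ cong (p ^ (t ∸ suc s) ·_) pˢ⁺¹x≡0 ⟩
      p ^ (t ∸ suc s) · 0ᴳ              ≡⟨ ·-zeroʳ _ ⟩
      0ᴳ                                ∎))
      where
      open ≡-Reasoning
      s<t = ≰⇒> t≰s

    -- writing m = u * p ^ t with p ∤ u, a nonzero multiple of x keeps the invariant, and
    -- any multiple having the invariant forces it on x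
    multiple-preserves : ∀ {m} x → 1 ≤ m → m · x ≢ 0ᴳ → HeadSocle x → HeadSocle (m · x)
    multiple-preserves {m} x 1≤m mx≢0 hx with p-adic m 1≤m
    ... | u , t , refl , p∤u =
      subst HeadSocle (scale-assoc _ u (p ^ t) x) (unit-preserves _ p∤u (power-preserves t x pᵗx≢0 hx))
      where
      pᵗx≢0 : p ^ t · x ≢ 0ᴳ
      pᵗx≢0 pᵗx≡0 = mx≢0 (trans (sym (scale-assoc _ u (p ^ t) x)) (trans (cong (u ·_) pᵗx≡0) (·-zeroʳ u)))

    multiple-reflects : ∀ {m} x → 1 ≤ m → HeadSocle (m · x) → HeadSocle x
    multiple-reflects {m} x 1≤m hmx with p-adic m 1≤m
    ... | u , t , refl , p∤u =
      power-reflects t x (unit-reflects _ p∤u (subst HeadSocle (sym (scale-assoc _ u (p ^ t) x)) hmx))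

    reach-preserves : ∀ {v w} → ReachAvoiding (PowerGraphProd (pows (a ∷ as))) (0ᴳ ∷ []) v w →
                      HeadSocle v → HeadSocle w
    reach-preserves here                           hv = hv
    reach-preserves (step (_ , inj₁ v→x) x∉0 path) hv with isPowerOf⇒scale _ _ _ v→x
    ... | m , 1≤m , refl = reach-preserves path (multiple-preserves _ 1≤m (λ x≡0 → x∉0 (here x≡0)) hv)
    reach-preserves (step (_ , inj₂ x→v) _   path) hv with isPowerOf⇒scale _ _ _ x→v
    ... | m , 1≤m , refl = reach-preserves path (multiple-reflects _ 1≤m hv)

  p^a≢0 : ∀ a → p ^ a ≢ 0
  p^a≢0 a pᵃ≡0 = <⇒≢ (m^n>0 p a) (sym pᵃ≡0)

  p^a<p^[1+a] : ∀ a → p ^ a < p ^ suc a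
  p^a<p^[1+a] a = subst (p ^ a <_) (*-comm (p ^ a) p) (m<m*n (p ^ a) p {{m^n≢0 p a}} 1<p)

  -- The elements
  -- e₁ = (p^a, 0, 0, …) and e₂ = (0, p^b, 0, …) of order p lie on different sides of the
  -- invariant HeadSocle, so {0} separates the power graph and κ = 1.
  module NonCyclic (a b : ℕ) (as : List ℕ) where
    ns : List ℕ
    ns = pows (suc a ∷ suc b ∷ as)

    pos : Pos ns
    pos = pows-pos (suc a ∷ suc b ∷ as)

    open PowerGraph ns pos
    open Socle (suc a) (suc b ∷ as) using (HeadSocle; reach-preserves)

    G : Graph
    G = PowerGraphProd ns

    rest : List ℕ
    rest = pows (suc b ∷ as)

    rest-pos : Pos rest
    rest-pos = pows-pos (suc b ∷ as)

    e₁ e₂ : Elem ns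
    e₁ = fromℕ< (p^a<p^[1+a] a) , 0ᴱ rest rest-pos
    e₂ = fromℕ< (m^n>0 p (suc a)) , fromℕ< (p^a<p^[1+a] b) , 0ᴱ (pows as) (pows-pos as)

    e₁≢0 : e₁ ≢ 0ᴳ
    e₁≢0 e₁≡0 = p^a≢0 a (trans (sym (toℕ-fromℕ< (p^a<p^[1+a] a))) (proj₁ (≡0ᴱ⇒isZero ns pos e₁ e₁≡0)))

    e₂≢0 : e₂ ≢ 0ᴳ
    e₂≢0 e₂≡0 = p^a≢0 b (trans (sym (toℕ-fromℕ< (p^a<p^[1+a] b))) (proj₁ (proj₂ (≡0ᴱ⇒isZero ns pos e₂ e₂≡0))))

    e₁≢e₂ : e₁ ≢ e₂
    e₁≢e₂ e₁≡e₂ = p^a≢0 a (begin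
      p ^ a                                  ≡⟨ sym (toℕ-fromℕ< (p^a<p^[1+a] a)) ⟩
      toℕ (proj₁ e₁)                         ≡⟨ cong (λ x → toℕ (proj₁ x)) e₁≡e₂ ⟩
      toℕ (fromℕ< (m^n>0 p (suc a)))         ≡⟨ toℕ-fromℕ< (m^n>0 p (suc a)) ⟩
      0                                      ∎)
      where open ≡-Reasoning

    e₁-headSocle : HeadSocle e₁
    e₁-headSocle =
      0 , isZero⇒≡0ᴱ ns pos _ (pe₁-head , ≡0ᴱ⇒isZero rest rest-pos _ (scale-zeroʳ rest rest-pos (p ^ 1))) ,
      λ hd≡0 → p^a≢0 a (trans (sym (toℕ-fromℕ< (p^a<p^[1+a] a))) (trans (cong toℕ (sym (·ᶠ-identity _))) hd≡0))
      where
      pe₁-head : toℕ (p ^ 1 ·ᶠ fromℕ< (p^a<p^[1+a] a)) ≡ 0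
      pe₁-head = ∣⇒·ᶠ≡0 (p ^ 1) _ (∣-reflexive (begin
        p ^ suc a                              ≡⟨ cong (_* p ^ a) (sym (*-identityʳ p)) ⟩
        p ^ 1 * p ^ a                          ≡⟨ cong (p ^ 1 *_) (sym (toℕ-fromℕ< (p^a<p^[1+a] a))) ⟩
        p ^ 1 * toℕ (fromℕ< (p^a<p^[1+a] a))  ∎))
        where open ≡-Reasoning

    e₂-not-headSocle : ¬ HeadSocle e₂
    e₂-not-headSocle (s , _ , hd≢0) = hd≢0 (·ᶠ-zero (p ^ s) _ (toℕ-fromℕ< (m^n>0 p (suc a))))

    zero-separates : IsSeparating G (0ᴳ ∷ [])
    zero-separates =
      ([] ∷ []) ,
      inj₁ (e₁ , e₂ , (λ { (here e₁≡0) → e₁≢0 e₁≡0 }) , (λ { (here e₂≡0) → e₂≢0 e₂≡0 }) ,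
            λ path → e₂-not-headSocle (reach-preserves path e₁-headSocle))

    κ≡1 : ∀ {κ} → IsVertexConnectivity G κ → κ ≡ 1
    κ≡1 = zeroSeparates⇒κ≡1 zero-separates e₁ e₂ e₁≢e₂

    1≤δ : ∀ {δ} → IsMinDegree G δ → 1 ≤ δ
    1≤δ = nonzero⇒1≤δ e₁ e₁≢0

    halvable⇒2≤δ′ : HalvesTwoTorsion → ∀ {δ} → IsMinDegree G δ → 2 ≤ δ
    halvable⇒2≤δ′ halve = halvable⇒2≤δ halve e₁ e₂ e₁≢0 e₂≢0 e₁≢e₂

  cyclic-complete : ∀ a → 1 ≤ a → let open Graph (PowerGraphProd (pows (a ∷ []))) in
                    ∀ u v → u ≢ v → Adj u v
  cyclic-complete a 1≤a (u , tt) (v , tt) u≢v with cyclic-comparable a 1≤a (toℕ u) (toℕ v)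
  ... | inj₁ (m , 1≤m , v≡mu) = u≢v , inj₁ (m , 1≤m , v≡mu , tt)
  ... | inj₂ (m , 1≤m , u≡mv) = u≢v , inj₂ (m , 1≤m , u≡mv , tt)

  cyclic⇒κ≡δ : ∀ a → 1 ≤ a → ∀ {κ δ} →
               IsVertexConnectivity (PowerGraphProd (pows (a ∷ []))) κ →
               IsMinDegree (PowerGraphProd (pows (a ∷ []))) δ → κ ≡ δ
  cyclic⇒κ≡δ a 1≤a = complete⇒κ≡δ (PowerGraphProd (pows (a ∷ []))) _≟ᴱ_ proj₁ (cyclic-complete a 1≤a)

  generatorAt : ∀ as → Any (_≡ 1) as → Elem (pows as)
  generatorAt (_ ∷ as) (here refl) = fromℕ< (p^a<p^[1+a] 0) , 0ᴱ (pows as) (pows-pos as)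
  generatorAt (a ∷ _)  (there i)   = fromℕ< (m^n>0 p a) , generatorAt _ i

  generatorAt≢0 : ∀ as i → generatorAt as i ≢ 0ᴱ (pows as) (pows-pos as)
  generatorAt≢0 (_ ∷ _)  (here refl) f≡0 = 1≢0 (begin
    1                                   ≡⟨ sym (toℕ-fromℕ< (p^a<p^[1+a] 0)) ⟩
    toℕ (fromℕ< (p^a<p^[1+a] 0))        ≡⟨ cong (λ x → toℕ (proj₁ x)) f≡0 ⟩
    toℕ (fromℕ< (m^n>0 p 1))            ≡⟨ toℕ-fromℕ< (m^n>0 p 1) ⟩
    0                                   ∎)
    where
    open ≡-Reasoning
    1≢0 : 1 ≢ 0
    1≢0 ()
  generatorAt≢0 (_ ∷ as) (there i)   f≡0 = generatorAt≢0 as i (cong proj₂ f≡0)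

  p·generatorAt≡0 : ∀ as i → scale (pows as) p (generatorAt as i) ≡ 0ᴱ (pows as) (pows-pos as)
  p·generatorAt≡0 as i = isZero⇒≡0ᴱ (pows as) (pows-pos as) _ (go as i)
    where
    go : ∀ as i → IsZero (pows as) (scale (pows as) p (generatorAt as i))
    go (_ ∷ as) (here refl) = ∣⇒·ᶠ≡0 p _ (∣-reflexive (cong (p *_) (sym (toℕ-fromℕ< (p^a<p^[1+a] 0))))) ,
                              ≡0ᴱ⇒isZero (pows as) (pows-pos as) _ (scale-zeroʳ (pows as) (pows-pos as) p)
    go (a ∷ as) (there i)   = ·ᶠ-zero p _ (toℕ-fromℕ< (m^n>0 p a)) , go as i

  generatorAt-not-p· : ∀ as i y → scale (pows as) p y ≢ generatorAt as i
  generatorAt-not-p· (_ ∷ _)  (here refl) (c , _)  py≡f = 0≢1 (begin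
    0                                   ≡⟨ sym (∣⇒·ᶠ≡0 p c (*-monoʳ-∣ p (1∣ toℕ c))) ⟩
    toℕ (p ·ᶠ c)                        ≡⟨ cong (λ x → toℕ (proj₁ x)) py≡f ⟩
    toℕ (fromℕ< (p^a<p^[1+a] 0))        ≡⟨ toℕ-fromℕ< (p^a<p^[1+a] 0) ⟩
    1                                   ∎)
    where
    open ≡-Reasoning
    0≢1 : 0 ≢ 1
    0≢1 ()
  generatorAt-not-p· (_ ∷ as) (there i)   (_ , ys) py≡f = generatorAt-not-p· as i ys (cong proj₂ py≡f)

  -- For p = 2, the generator f of a factor Z/2 has 0 as its only neighbour:
  -- its multiples are 0 and f, and f = m·w forces m odd (f is not a double), hence
  -- 2·w = 0 (m is a unit) and f = m·w = w.  So δ ≤ 1.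
  factorZ₂⇒δ≤1 : p ≡ 2 → ∀ as → Any (_≡ 1) as →
                 ∀ {δ} → IsMinDegree (PowerGraphProd (pows as)) δ → δ ≤ 1
  factorZ₂⇒δ≤1 refl as i (_ , minimal) = minimal f 1 ((0ᴳ ∷ []) , (([] ∷ []) , neighbours) , refl)
    where
    open PowerGraph (pows as) (pows-pos as)
    open Graph (PowerGraphProd (pows as)) using (Adj)

    f = generatorAt as i
    2f≡0 = p·generatorAt≡0 as i

    onlyZero : ∀ w → Adj f w → w ∈ 0ᴳ ∷ []
    onlyZero w (f≢w , inj₁ f→w) with isPowerOf⇒scale _ _ _ f→w
    ... | m , _ , refl with 2 ∣? m
    ...   | yes (divides q refl) = here (even-on-2torsion q f 2f≡0)
    ...   | no  2∤m              = ⊥-elim (f≢w (sym (odd-on-2torsion f 2∤m 2f≡0)))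
    onlyZero w (f≢w , inj₂ w→f) with isPowerOf⇒scale _ _ _ w→f
    ... | m , _ , f≡mw with 2 ∣? m
    ...   | yes (divides q refl) = ⊥-elim (generatorAt-not-p· as i (q · w) (trans (sym (even-is-double q w)) (sym f≡mw)))
    ...   | no  2∤m              = ⊥-elim (f≢w (trans f≡mw (odd-on-2torsion w 2∤m 2w≡0)))
      where
      2w≡0 : 2 · w ≡ 0ᴳ
      2w≡0 = unit-cancelᴱ 2∤m as (2 · w) (begin
        m · 2 · w   ≡⟨ scale-comm _ m 2 w ⟩
        2 · m · w   ≡⟨ cong (2 ·_) (sym f≡mw) ⟩
        2 · f       ≡⟨ 2f≡0 ⟩
        0ᴳ          ∎)
        where open ≡-Reasoning

    neighbours : ∀ w → (w ∈ 0ᴳ ∷ []) ⇔ Adj f w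
    neighbours w = mk⇔ (λ { (here refl) → proj₁ (zero-dominates f (generatorAt≢0 as i)) }) (onlyZero w)

minExp-≤ : ∀ a → All (minExp a ≤_) (toList a)
minExp-≤ (x ∷ xs) =
  foldr-preservesʳ (λ y {z} z≤x → ≤-trans (m⊓n≤n y z) z≤x) ≤-refl xs ∷
  foldr-forcesᵇ (λ y z m≤y⊓z → ≤-trans m≤y⊓z (m⊓n≤m y z) , ≤-trans m≤y⊓z (m⊓n≤n y z)) x xs ≤-refl

minExp-∈ : ∀ a → minExp a ∈ toList a
minExp-∈ (x ∷ xs) with foldr-selective ⊓-sel x xs
... | inj₁ m≡x  = here m≡x
... | inj₂ m∈xs = there m∈xs

minExp-pos : ∀ a → All (1 ≤_) (toList a) → 1 ≤ minExp a
minExp-pos (x ∷ xs) (1≤x ∷ 1≤xs) = foldr-preservesᵇ ⊓-glb 1≤x 1≤xs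

p^k≡2 : ∀ p k → 2 ≤ p → p ^ k ≡ 2 → p ≡ 2 × k ≡ 1
p^k≡2 p zero          _   ()
p^k≡2 p (suc zero)    _   pᵏ≡2 = trans (sym (*-identityʳ p)) pᵏ≡2 , refl
p^k≡2 p (suc (suc k)) 2≤p pᵏ≡2 = ⊥-elim (<⇒≢ 2<pᵏ (sym pᵏ≡2))
  where
  2<pᵏ : 2 < p ^ suc (suc k)
  2<pᵏ = ≤-trans (s≤s (s≤s (s≤s z≤n))) (*-mono-≤ 2≤p (*-mono-≤ 2≤p (m^n>0 p {{>-nonZero (≤-trans (s≤s z≤n) 2≤p)}} k)))

τ≡2⇒ : ∀ {p} → Prime p → ∀ a → τ p a ≡ 2 → p ≡ 2 × Any (_≡ 1) (toList a)
τ≡2⇒ {p} p-prime a τ≡2 with p^k≡2 p (minExp a) (PrimeModuli.1<p p-prime) τ≡2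
... | p≡2 , m≡1 = p≡2 , Any.map (λ m≡x → trans (sym m≡x) m≡1) (minExp-∈ a)

τ≢2⇒ : ∀ p a → All (1 ≤_) (toList a) → τ p a ≢ 2 → p ≢ 2 ⊎ (p ≡ 2 × All (2 ≤_) (toList a))
τ≢2⇒ p a 1≤a τ≢2 with p ≟ 2
... | no  p≢2  = inj₁ p≢2
... | yes refl = inj₂ (refl , All.map (≤-trans 2≤m) (minExp-≤ a))
  where
  2≤m : 2 ≤ minExp a
  2≤m = ≤∧≢⇒< (minExp-pos a 1≤a) (λ 1≡m → τ≢2 (cong (2 ^_) (sym 1≡m)))

theorem6p8 : (p : ℕ) → Prime p → (a : List⁺ ℕ) → All (1 ≤_) (toList a)
    → (κ δ : ℕ)
    → IsVertexConnectivity (PGroupPowerGraph p a) κ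
    → IsMinDegree (PGroupPowerGraph p a) δ
    → (κ ≡ δ) ⇔ (σ a ≡ 1 ⊎ τ p a ≡ 2)
theorem6p8 p p-prime (a ∷ []) (1≤a ∷ []) κ δ vc md =
  mk⇔ (λ _ → inj₁ refl) (λ _ → PGroup.cyclic⇒κ≡δ p-prime a 1≤a vc md)
theorem6p8 p p-prime exps@(suc a ∷ suc b ∷ as) 1≤exps@(s≤s z≤n ∷ s≤s z≤n ∷ _) κ δ vc md =
  mk⇔ κ≡δ⇒τ≡2 τ≡2⇒κ≡δ
  where
  open PGroup p-prime
  open NonCyclic a b as using (κ≡1; 1≤δ; halvable⇒2≤δ′)

  -- if τ ≠ 2, elements of order 2 are halvable, so δ ≥ 2 > 1 = κ
  κ≡δ⇒τ≡2 : κ ≡ δ → σ exps ≡ 1 ⊎ τ p exps ≡ 2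
  κ≡δ⇒τ≡2 κ≡δ with τ p exps ≟ 2
  ... | yes τ≡2 = inj₂ τ≡2
  ... | no  τ≢2 = ⊥-elim (<⇒≱ (halvable⇒2≤δ′ halve md) (≤-reflexive (trans (sym κ≡δ) (κ≡1 vc))))
    where
    halve : PowerGraph.HalvesTwoTorsion (pows (toList exps)) (pows-pos (toList exps))
    halve = [ (λ p≢2 → odd⇒halvable p≢2 (toList exps)) , (λ (p≡2 , 2≤exps) → two⇒halvable p≡2 (toList exps) 2≤exps) ]
              (τ≢2⇒ p exps 1≤exps τ≢2)

  -- if τ = 2, the generator of a factor Z/2 has degree 1, so δ = 1 = κ
  τ≡2⇒κ≡δ : σ exps ≡ 1 ⊎ τ p exps ≡ 2 → κ ≡ δ
  τ≡2⇒κ≡δ (inj₁ ())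
  τ≡2⇒κ≡δ (inj₂ τ≡2) with τ≡2⇒ p-prime exps τ≡2
  ... | p≡2 , i = trans (κ≡1 vc) (≤-antisym (1≤δ md) (factorZ₂⇒δ≤1 p≡2 (toList exps) i md))
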